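{- Let $l \geq 1$ and $1 \leq s_1 \leq \cdots \leq s_l$ be integers, and let $\mathcal{K}_{1,s_1,\ldots,s_l}$ be the complete $(l+1)$-partite graph with parts of sizes $1, s_1, \ldots, s_l$. If $V_1, \ldots, V_l$ is a partition of the vertex set of $\mathcal{K}_{1,s_1,\ldots,s_l}$ such that for every $i \in [l]$, every $v \in V_i$ has at most $s_1 - 1$ neighbours in $V_i$, then for some $i$ the set $V_i$ contains a 3-cycle.
   Context: Graphs are undirected and loopless. "$V_i$ contains a 3-cycle" means that there are three vertices in $V_i$ that are pairwise adjacent. -}

module Defs where

open import Data.Nat using (ℕ; suc)
open import Data.Fin using (Fin; zero; suc; _≟_)
open import Data.Fin using () renaming (_≤_ to _≤ᶠ_)
open import Data.Product using (Σ; _,_; proj₁; _×_)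
open import Data.List using (List; concatMap; map; filter; length; allFin)
open import Relation.Binary.PropositionalEquality using (_≡_; _≢_)
open import Relation.Nullary using (¬?)
open import Relation.Nullary.Decidable using (_×-dec_)

-- The complete (k+2)-partite graph K_{1,s_1,...,s_{k+1}} (so l = k+1 ≥ 1).
-- Parts are indexed by Fin (suc (suc k)); part zero is the single apex
-- vertex, part (suc i) has size s i.
partSize : ∀ {k} → (Fin (suc k) → ℕ) → Fin (suc (suc k)) → ℕ
partSize s zero    = 1
partSize s (suc i) = s i

Vertex : ∀ {k} → (Fin (suc k) → ℕ) → Set
Vertex {k} s = Σ (Fin (suc (suc k))) (λ p → Fin (partSize s p))

Adj : ∀ {k} (s : Fin (suc k) → ℕ) → Vertex s → Vertex s → Set
Adj s u v = proj₁ u ≢ proj₁ v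

allVertices : ∀ {k} (s : Fin (suc k) → ℕ) → List (Vertex s)
allVertices {k} s = concatMap (λ p → map (p ,_) (allFin (partSize s p))) (allFin (suc (suc k)))

-- A partition V_1,...,V_l of the vertex set, given by the class map c.
-- Number of neighbours of v lying in the same class as v.
sameClassDegree : ∀ {k} (s : Fin (suc k) → ℕ) (c : Vertex s → Fin (suc k)) → Vertex s → ℕ
sameClassDegree s c v =
  length (filter (λ u → ¬? (proj₁ u ≟ proj₁ v) ×-dec (c u ≟ c v)) (allVertices s))

NonDecreasing : ∀ {k} → (Fin (suc k) → ℕ) → Set
NonDecreasing {k} s = ∀ (i j : Fin (suc k)) → i ≤ᶠ j → Data.Nat._≤_ (s i) (s j)
  where import Data.Nat

HasTriangleIn : ∀ {k} (s : Fin (suc k) → ℕ) (c : Vertex s → Fin (suc k)) → Fin (suc k) → Set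
HasTriangleIn s c i =
  Σ (Vertex s) λ x → Σ (Vertex s) λ y → Σ (Vertex s) λ z →
    (c x ≡ i × c y ≡ i × c z ≡ i) × (Adj s x y × Adj s y z × Adj s x z)

-- Say that a class meets a part if it contains a vertex of that part.  Two
-- vertices are adjacent exactly when their parts differ, so a class meeting
-- three parts contains a triangle.  If part j ≥ 1 were met by a single class
-- that also met another part, a vertex of that other part would have all
-- s_j ≥ s_1 vertices of part j as neighbours in its class; hence every part
-- j ≥ 1 is met by two classes or by a class meeting no other part.  Assign
-- to each class two labels, one for the first part it meets and one for any
-- later part.  The apex takes one label and each of the l other parts takes
-- two distinct ones (a class meeting only that part gives both its labels to
-- it), so 2l + 1 tokens receive labels from 2l, and two tokens at different
-- parts share the label of a class: that class meets an earlier part as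
-- well, three parts in all.
module Submission where

open import Defs
open import Data.Nat using (ℕ; _≤_; _∸_)
open import Data.Fin using (Fin; zero)
open import Data.Product using (Σ)

open import Data.Bool using (Bool; true; false)
open import Data.Empty using (⊥-elim)
open import Data.Fin using (suc; _<_; _≟_; fromℕ<)
open import Data.Fin.Properties
  using (any?; _<?_; <-cmp; <⇒≢; <-trans; pigeonhole; 1↔⊤; 2↔Bool; +↔⊎; *↔×)
open import Data.List using (List; _∷_; filter; length; map; concatMap; allFin)
open import Data.List.Properties using (filter-++; length-++; filter-all; length-map; length-tabulate)
open import Data.List.Membership.Propositional using (_∈_)
open import Data.List.Membership.Propositional.Properties using (∈-allFin)
open import Data.List.Relation.Unary.Any using (here; there)
open import Data.List.Relation.Unary.All.Properties using (map⁺; tabulate⁺)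
open import Data.Nat using (_*_; z≤n; s≤s; z<s)
open import Data.Nat.Properties
  using (≤-refl; ≤-trans; m≤m+n; m≤n+m; *-monoˡ-≤; ∸-monoʳ-<; n≮n; module ≤-Reasoning)
open import Data.Product using (_,_; proj₁; proj₂; _×_; ∃; ∃₂)
open import Data.Product.Function.NonDependent.Propositional using (_×-↔_)
open import Data.Sum using (_⊎_; inj₁; inj₂)
open import Data.Sum.Function.Propositional using (_⊎-↔_)
open import Data.Unit using (⊤)
open import Function using (_∘_; id; _↣_; _↔_; Injective; Injection)
open import Function.Construct.Composition using (_↔-∘_)
open import Function.Properties.Inverse using (↔-refl; ↔-sym; ↔⇒↣)
open import Relation.Binary using (tri<; tri≈; tri>)
open import Relation.Binary.PropositionalEquality using (_≡_; _≢_; refl; sym; trans; cong; subst)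
open import Relation.Nullary using (Dec; yes; no; ¬?; does)
open import Relation.Nullary.Decidable using (_×-dec_; dec-true; decidable-stable)
open import Relation.Unary using (Decidable)

pigeonhole-↣ : ∀ {a b} {A B : Set} → ℕ.suc b ≤ a → Fin a ↣ A → B ↣ Fin b →
  (f : A → B) → ∃₂ λ x y → x ≢ y × f x ≡ f y
pigeonhole-↣ b<a enum code f
  with i , j , i<j , fi≡fj ← pigeonhole b<a (Injection.to code ∘ f ∘ Injection.to enum)
  = Injection.to enum i , Injection.to enum j
  , <⇒≢ i<j ∘ Injection.injective enum , Injection.injective code fi≡fj

*2↔×Bool : ∀ {n} → Fin (n * 2) ↔ (Fin n × Bool)
*2↔×Bool = (↔-refl ×-↔ 2↔Bool) ↔-∘ *↔×

∈⇒length-filter-≤-concatMap : ∀ {A B : Set} {P : B → Set} (P? : Decidable P)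
  (f : A → List B) {x xs} → x ∈ xs →
  length (filter P? (f x)) ≤ length (filter P? (concatMap f xs))
∈⇒length-filter-≤-concatMap P? f {xs = y ∷ ys} x∈xs
  rewrite filter-++ P? (f y) (concatMap f ys) | length-++ (filter P? (f y)) {filter P? (concatMap f ys)}
  with x∈xs
... | here refl = m≤m+n _ _
... | there x∈ys = ≤-trans (∈⇒length-filter-≤-concatMap P? f x∈ys) (m≤n+m _ _)

module Incidence {m n : ℕ} (Meets : Fin m → Fin (ℕ.suc n) → Set)
                 (meets? : ∀ i p → Dec (Meets i p)) where

  MeetsThreeParts : Fin m → Set
  MeetsThreeParts i = ∃₂ λ p q → ∃ λ r → p < q × q < r × Meets i p × Meets i q × Meets i r

  Exclusive : Fin m → Fin (ℕ.suc n) → Set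
  Exclusive i p = ∀ q → Meets i q → q ≡ p

  Rich : Fin (ℕ.suc n) → Set
  Rich p = (∃₂ λ i i′ → i ≢ i′ × Meets i p × Meets i′ p) ⊎ (∃ λ i → Meets i p × Exclusive i p)

  MetBefore : Fin m → Fin (ℕ.suc n) → Set
  MetBefore i p = ∃ λ q → q < p × Meets i q

  metBefore? : ∀ i p → Dec (MetBefore i p)
  metBefore? i p = any? λ q → (q <? p) ×-dec meets? i q

  rank : Fin m → Fin (ℕ.suc n) → Bool
  rank i p = does (metBefore? i p)

  rank≡true⇒metBefore : ∀ {i p} → rank i p ≡ true → MetBefore i p
  rank≡true⇒metBefore {i} {p} = does≡true⇒ (metBefore? i p)
    where
    does≡true⇒ : ∀ {A : Set} (a? : Dec A) → does a? ≡ true → A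
    does≡true⇒ (yes a) _ = a

  metBefore⇒rank≡true : ∀ {i p} → MetBefore i p → rank i p ≡ true
  metBefore⇒rank≡true {i} {p} = dec-true (metBefore? i p)

  Label : Set
  Label = Fin m × Bool

  -- An exclusive class may spend both of its labels on its only part.
  Admissible : Fin (ℕ.suc n) → Label → Set
  Admissible p (i , b) = Meets i p × (b ≡ rank i p ⊎ Exclusive i p)

  rank-collision : ∀ {i p q} → p < q → Meets i p → Meets i q → rank i p ≡ rank i q →
    MeetsThreeParts i
  rank-collision p<q mp mq rp≡rq
    with o , o<p , mo ← rank≡true⇒metBefore (trans rp≡rq (metBefore⇒rank≡true (_ , p<q , mp)))
    = o , _ , _ , o<p , p<q , mo , mp , mq

  admissible-collision : ∀ {p q ℓ} → p ≢ q → Admissible p ℓ → Admissible q ℓ →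
    ∃ MeetsThreeParts
  admissible-collision p≢q (mp , inj₂ excl) (mq , _) = ⊥-elim (p≢q (sym (excl _ mq)))
  admissible-collision p≢q (mp , _) (mq , inj₂ excl) = ⊥-elim (p≢q (excl _ mp))
  admissible-collision {p} {q} p≢q (mp , inj₁ b≡rp) (mq , inj₁ b≡rq) with <-cmp p q
  ... | tri< p<q _ _ = _ , rank-collision p<q mp mq (trans (sym b≡rp) b≡rq)
  ... | tri≈ _ p≡q _ = ⊥-elim (p≢q p≡q)
  ... | tri> _ _ q<p = _ , rank-collision q<p mq mp (trans (sym b≡rq) b≡rp)

  TwoLabels : Fin (ℕ.suc n) → Set
  TwoLabels p = Σ (Bool → Label) λ ℓ → Injective _≡_ _≡_ ℓ × (∀ b → Admissible p (ℓ b))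

  rich⇒twoLabels : ∀ {p} → Rich p → TwoLabels p
  rich⇒twoLabels {p} (inj₁ (i , i′ , i≢i′ , mi , mi′)) = ℓ , injective , admissible
    where
    ℓ : Bool → Label
    ℓ false = i , rank i p
    ℓ true  = i′ , rank i′ p
    injective : Injective _≡_ _≡_ ℓ
    injective {false} {false} _ = refl
    injective {false} {true}  e = ⊥-elim (i≢i′ (cong proj₁ e))
    injective {true}  {false} e = ⊥-elim (i≢i′ (cong proj₁ (sym e)))
    injective {true}  {true}  _ = refl
    admissible : ∀ b → Admissible p (ℓ b)
    admissible false = mi , inj₁ refl
    admissible true  = mi′ , inj₁ refl
  rich⇒twoLabels (inj₂ (i , mi , excl)) = (i ,_) , cong proj₂ , λ _ → mi , inj₂ excl

  module Tokens (i₀ : Fin m) (mi₀ : Meets i₀ zero) (two : ∀ j → TwoLabels (suc j)) where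

    Token : Set
    Token = ⊤ ⊎ (Fin n × Bool)

    part : Token → Fin (ℕ.suc n)
    part (inj₁ _)       = zero
    part (inj₂ (j , _)) = suc j

    label : Token → Label
    label (inj₁ _)       = i₀ , rank i₀ zero
    label (inj₂ (j , b)) = proj₁ (two j) b

    label-admissible : ∀ t → Admissible (part t) (label t)
    label-admissible (inj₁ _)       = mi₀ , inj₁ refl
    label-admissible (inj₂ (j , b)) = proj₂ (proj₂ (two j)) b

    label-injective-within-part : ∀ t t′ → part t ≡ part t′ → label t ≡ label t′ → t ≡ t′
    label-injective-within-part (inj₁ _) (inj₁ _) _ _ = refl
    label-injective-within-part (inj₂ (j , b)) (inj₂ (.j , b′)) refl ℓ≡ =
      cong (λ b → inj₂ (j , b)) (proj₁ (proj₂ (two j)) ℓ≡)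

    tokens↔ : Fin (ℕ.suc (n * 2)) ↔ Token
    tokens↔ = (1↔⊤ ⊎-↔ *2↔×Bool) ↔-∘ +↔⊎ {1}

    label-collision : m ≤ n → ∃ MeetsThreeParts
    label-collision m≤n
      with t , t′ , t≢t′ , same ← pigeonhole-↣ (s≤s (*-monoˡ-≤ 2 m≤n)) (↔⇒↣ tokens↔)
                                              (↔⇒↣ (↔-sym *2↔×Bool)) label
      with part t ≟ part t′
    ... | yes p≡p′ = ⊥-elim (t≢t′ (label-injective-within-part t t′ p≡p′ same))
    ... | no p≢p′ = admissible-collision p≢p′ (label-admissible t)
                      (subst (Admissible (part t′)) (sym same) (label-admissible t′))

  some-class-meets-three-parts : m ≤ n → ∃ (λ i → Meets i zero) → (∀ j → Rich (suc j)) →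
    ∃ MeetsThreeParts
  some-class-meets-three-parts m≤n (i₀ , mi₀) rich =
    Tokens.label-collision i₀ mi₀ (rich⇒twoLabels ∘ rich) m≤n

partSize≤sameClassDegree : ∀ {k} (s : Fin (ℕ.suc k) → ℕ) (c : Vertex s → Fin (ℕ.suc k))
  (v : Vertex s) p → p ≢ proj₁ v → (∀ x → c (p , x) ≡ c v) → partSize s p ≤ sameClassDegree s c v
partSize≤sameClassDegree s c v p p≢v sameClass = begin
  partSize s p                    ≡⟨ sym (trans (length-map inPart (allFin (partSize s p))) (length-tabulate id)) ⟩
  length partList                 ≡⟨ cong length (filter-all P? (map⁺ (tabulate⁺ {f = id} λ x → p≢v , sameClass x))) ⟨
  length (filter P? partList)     ≤⟨ ∈⇒length-filter-≤-concatMap P? (λ q → map (q ,_) (allFin (partSize s q))) (∈-allFin p) ⟩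
  sameClassDegree s c v           ∎
  where
  open ≤-Reasoning
  P? = λ (u : Vertex s) → ¬? (proj₁ u ≟ proj₁ v) ×-dec (c u ≟ c v)
  inPart : Fin (partSize s p) → Vertex s
  inPart = p ,_
  partList : List (Vertex s)
  partList = map inPart (allFin (partSize s p))

module _ {k : ℕ} (s : Fin (ℕ.suc k) → ℕ) (c : Vertex s → Fin (ℕ.suc k)) where

  ClassMeets : Fin (ℕ.suc k) → Fin (ℕ.suc (ℕ.suc k)) → Set
  ClassMeets i p = ∃ λ x → c (p , x) ≡ i

  classMeets? : ∀ i p → Dec (ClassMeets i p)
  classMeets? i p = any? λ x → c (p , x) ≟ i

  open Incidence ClassMeets classMeets?

  meetsThreeParts⇒triangle : ∀ {i} → MeetsThreeParts i → HasTriangleIn s c i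
  meetsThreeParts⇒triangle (p , q , r , p<q , q<r , (x , cx) , (y , cy) , (z , cz)) =
    (p , x) , (q , y) , (r , z) , (cx , cy , cz) , (<⇒≢ p<q , <⇒≢ q<r , <⇒≢ (<-trans p<q q<r))

  module _ (s₀≥1 : 1 ≤ s zero) (nondecreasing : NonDecreasing s)
           (degree-bound : ∀ v → sameClassDegree s c v ≤ s zero ∸ 1) where

    s₀≤s : ∀ j → s zero ≤ s j
    s₀≤s j = nondecreasing zero j z≤n

    x₀ : ∀ {j} → Fin (s j)
    x₀ {j} = fromℕ< (≤-trans s₀≥1 (s₀≤s j))

    monochromatic-part-exclusive : ∀ j i → (∀ x → c (suc j , x) ≡ i) → Exclusive i (suc j)
    monochromatic-part-exclusive j i mono q (y , cy≡i) = decidable-stable (q ≟ suc j) λ q≢j →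
      n≮n (s j) (begin-strict
        s j                         ≤⟨ partSize≤sameClassDegree s c (q , y) (suc j) (q≢j ∘ sym)
                                         (λ x → trans (mono x) (sym cy≡i)) ⟩
        sameClassDegree s c (q , y) ≤⟨ degree-bound (q , y) ⟩
        s zero ∸ 1                  <⟨ ∸-monoʳ-< z<s s₀≥1 ⟩
        s zero                      ≤⟨ s₀≤s j ⟩
        s j                         ∎)
      where open ≤-Reasoning

    part-rich : ∀ j → Rich (suc j)
    part-rich j with any? (λ x → ¬? (c (suc j , x) ≟ c (suc j , x₀)))
    ... | yes (x , cx≢cx₀) = inj₁ (_ , _ , cx≢cx₀ , (x , refl) , (x₀ , refl))
    ... | no monochromatic = inj₂ (_ , (x₀ , refl) , monochromatic-part-exclusive j _ λ x →
            decidable-stable (c (suc j , x) ≟ c (suc j , x₀)) λ cx≢cx₀ → monochromatic (x , cx≢cx₀))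

lemma6p1 : (k : ℕ) (s : Fin (ℕ.suc k) → ℕ) →
    1 ≤ s zero → NonDecreasing s →
    (c : Vertex s → Fin (ℕ.suc k)) →
    (∀ v → sameClassDegree s c v ≤ s zero ∸ 1) →
    Σ (Fin (ℕ.suc k)) (λ i → HasTriangleIn s c i)
lemma6p1 k s s₀≥1 nondecreasing c degree-bound
  with i , three ← Incidence.some-class-meets-three-parts (ClassMeets s c) (classMeets? s c) ≤-refl
                     (c (zero , zero) , zero , refl) (part-rich s c s₀≥1 nondecreasing degree-bound)
  = i , meetsThreeParts⇒triangle s c three
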